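{- Let $r\ge2$. Let $\xi_{r,r-1}:\Delta_{r,r-1}\to[r]^{(r-1)}$ be the simplicial map sending a non-taking rook placement $\{(i_1,j_1),\ldots,(i_p,j_p)\}$ to $\{i_1,\ldots,i_p\}$. Then, with respect to the orientations specified in the context, $${\rm deg}(\xi_{r,r-1})=(-1)^{r+1}(r-1)!.$$
   Context: The chessboard complex $\Delta_{m,n}$ is the simplicial complex on vertex set $[m]\times[n]$ whose simplices are sets of pairs with pairwise distinct first coordinates and pairwise distinct second coordinates (non-taking rook placements); $\Delta_{r,r-1}$ is an orientable $(r-2)$-dimensional pseudomanifold. For $k\le m$, $[m]^{(k)}=\{A\subset[m]:|A|\le k\}$ is the $(k-1)$-skeleton of the simplex $\sigma^{m-1}$ on $[m]$, so $[r]^{(r-1)}=\partial\sigma^{r-1}$ is a triangulated $(r-2)$-sphere. Orientations: $\Delta_{r,r-1}$ has fundamental class $\sum_{\pi\in S_r}{\rm sgn}(\pi)\,\widetilde\sigma_\pi$, where $\widetilde\sigma_\pi$ is the ordered simplex $((\pi_1,1),(\pi_2,2),\ldots,(\pi_{r-1},r-1))$; $\partial\sigma^{r-1}$ has fundamental class $\sum_{i=1}^r(-1)^{i-1}(1,\ldots,\widehat{i},\ldots,r)$. -}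

module Defs where

open import Data.Bool using (Bool; true; false; _∧_; _∨_; not; if_then_else_)
open import Data.Nat as ℕ using (ℕ; zero; suc; _∸_; _≡ᵇ_; _<ᵇ_)
open import Data.Integer as ℤ using (ℤ; +_; 0ℤ; 1ℤ; -_)
open import Data.Fin using (Fin; toℕ)
open import Data.Fin.Properties using () renaming (_≟_ to _≟ᶠ_)
open import Data.List using (List; []; _∷_; map; length; zip; concatMap; filterᵇ; allFin; foldr)
open import Data.Maybe using (Maybe; just; nothing)
open import Data.Product using (_×_; _,_; proj₁)
open import Relation.Binary using (DecidableEquality)
open import Relation.Nullary.Decidable using (does)
open import Relation.Binary.PropositionalEquality using (_≡_)

-- A chain is a formal ℤ-combination of ordered simplices (lists of
-- vertices), subject to the usual relations: an ordered simplex with a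
-- repeated vertex is 0, and reordering the vertices by a permutation
-- multiplies by its sign.  Two chains are equal iff they have the same
-- coefficient on every ordered simplex t (with distinct vertices),
-- where the coefficient is computed via 'rel' below.

sgnPow : ℕ → ℤ
sgnPow k = (- 1ℤ) ℤ.^ k

inversions : List ℕ → ℕ
inversions []       = 0
inversions (x ∷ xs) = length (filterᵇ (λ y → y <ᵇ x) xs) ℕ.+ inversions xs

module _ {V : Set} (_≟_ : DecidableEquality V) where

  elem : V → List V → Bool
  elem v []       = false
  elem v (w ∷ ws) = does (v ≟ w) ∨ elem v ws

  nodup : List V → Bool
  nodup []       = true
  nodup (v ∷ vs) = not (elem v vs) ∧ nodup vs

  pos : V → List V → Maybe ℕ
  pos v []       = nothing
  pos v (w ∷ ws) with does (v ≟ w)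
  ... | true  = just 0
  ... | false with pos v ws
  ...   | just k  = just (suc k)
  ...   | nothing = nothing

  positions : List V → List V → Maybe (List ℕ)
  positions []       t = just []
  positions (v ∷ vs) t with pos v t | positions vs t
  ... | just k | just ks = just (k ∷ ks)
  ... | _      | _       = nothing

  -- rel s t : the scalar c with  [s] = c · [t]  when s is a reordering
  -- of t (c = sign of the reordering); 0 if s is degenerate or s is not
  -- a reordering of t.
  rel : List V → List V → ℤ
  rel s t with nodup s ∧ nodup t ∧ (length s ≡ᵇ length t)
  ... | false = 0ℤ
  ... | true with positions s t
  ...   | nothing = 0ℤ
  ...   | just ps = sgnPow (inversions ps)

Chain : Set → Set
Chain V = List (ℤ × List V)

coeff : {V : Set} → DecidableEquality V → Chain V → List V → ℤ
coeff eq c t = foldr (λ { (a , s) acc → a ℤ.* rel eq s t ℤ.+ acc }) 0ℤ c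

pushforward : {V W : Set} → (V → W) → Chain V → Chain W
pushforward f = map (λ { (a , s) → a , map f s })

HasDegree : {V W : Set} → DecidableEquality W → (V → W) → Chain V → Chain W → ℤ → Set
HasDegree eqW f z z' d = ∀ (t : List _) → coeff eqW (pushforward f z) t ≡ d ℤ.* coeff eqW z' t

-- Chessboard complex Δ_{r,r-1} and the boundary sphere ∂σ^{r-1}.
-- Vertices [m] and [n] are modelled as Fin m, Fin n (0-based).

tuples : (m k : ℕ) → List (List (Fin m))
tuples m zero    = [] ∷ []
tuples m (suc k) = concatMap (λ x → map (x ∷_) (tuples m k)) (allFin m)

perms : (r : ℕ) → List (List (Fin r))
perms r = filterᵇ (nodup _≟ᶠ_) (tuples r r)

sgn : {r : ℕ} → List (Fin r) → ℤ
sgn π = sgnPow (inversions (map toℕ π))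

rookSimplex : (r : ℕ) → List (Fin r) → List (Fin r × Fin (r ∸ 1))
rookSimplex r π = zip π (allFin (r ∸ 1))

chessFund : (r : ℕ) → Chain (Fin r × Fin (r ∸ 1))
chessFund r = map (λ π → sgn π , rookSimplex r π) (perms r)

sphereFund : (r : ℕ) → Chain (Fin r)
sphereFund r = map (λ i → sgnPow (toℕ i) , filterᵇ (λ j → not (does (j ≟ᶠ i))) (allFin r)) (allFin r)

ξ : (r : ℕ) → Fin r × Fin (r ∸ 1) → Fin r
ξ r = proj₁

module Submission where

-- The coefficient of ξ_#[Δ_{r,r-1}] on an ordered face t of ∂σ^{r-1} vanishes, as does that of
-- [∂σ^{r-1}], unless t lists r-1 distinct vertices, i.e. all vertices but one, k (counted from 0).
-- The rook placements mapped onto the vertex set of t are then the permutations π = σ ++ [ k ] with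
-- σ an ordering of t; sgn π = sgn σ · (-1)^(r-1-k) and [σ] = sgn σ · sgn t · [t], so each of the
-- (r-1)! orderings contributes (-1)^(r-1-k) sgn t, whereas [∂σ^{r-1}] has coefficient (-1)^k sgn t on t.

open import Data.Bool using (Bool; true; false; _∧_; _∨_; not; if_then_else_)
open import Data.Bool.Properties as Bool using (∧-zeroʳ; ¬-not)
open import Data.Empty using (⊥-elim)
open import Data.Fin using (Fin; toℕ) renaming (zero to fzero; suc to fsuc)
open import Data.Fin.Properties using (_≟_; toℕ-injective; toℕ≤pred[n])
open import Data.Integer as ℤ using (ℤ; +_; -_; 0ℤ; 1ℤ; -1ℤ; _*_; _^_)
import Data.Integer.Properties as ℤₚ
open import Data.Integer.Tactic.RingSolver using (solve-∀)
open import Data.List using (List; []; _∷_; [_]; map; length; filterᵇ; _++_; allFin; foldr; concatMap; zip)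
open import Data.List.Properties using (map-∘; map-tabulate; length-tabulate; map-++)
open import Data.Maybe using (just; nothing)
open import Data.Nat as ℕ using (ℕ; zero; suc; _+_; _∸_; _≤_; _<_; _<ᵇ_; _≡ᵇ_; z≤n; s≤s; _!)
import Data.Nat.Properties as ℕₚ
open import Algebra.Properties.CommutativeSemigroup ℕₚ.+-commutativeSemigroup using (x∙yz≈y∙xz)
import Data.Nat.Tactic.RingSolver as ℕ-Solver
open import Data.Product using (_×_; _,_; proj₁; proj₂; ∃-syntax)
open import Data.Sum using (_⊎_; inj₁; inj₂)
open import Defs
open import Function using (_∘′_)
open import Relation.Binary using (DecidableEquality)
open import Relation.Binary.PropositionalEquality hiding ([_])
open import Relation.Nullary using (¬_; yes; no; does; _×-dec_)

open ≡-Reasoning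

-- Signs, counting and inversions

sgnPow-+ : ∀ a b → sgnPow (a + b) ≡ sgnPow a * sgnPow b
sgnPow-+ zero    b = sym (ℤₚ.*-identityˡ (sgnPow b))
sgnPow-+ (suc a) b = trans (cong (-1ℤ *_) (sgnPow-+ a b)) (sym (ℤₚ.*-assoc -1ℤ (sgnPow a) (sgnPow b)))

sgnPow-square : ∀ a → sgnPow a * sgnPow a ≡ 1ℤ
sgnPow-square zero    = refl
sgnPow-square (suc a) = trans (rearrange -1ℤ (sgnPow a)) (trans (ℤₚ.*-identityˡ _) (sgnPow-square a))
  where
  rearrange : ∀ u v → (u * v) * (u * v) ≡ (u * u) * (v * v)
  rearrange = solve-∀

sgnPow-cancelˡ : ∀ a x → sgnPow a * (sgnPow a * x) ≡ x
sgnPow-cancelˡ a x = begin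
  sgnPow a * (sgnPow a * x)  ≡⟨ ℤₚ.*-assoc (sgnPow a) (sgnPow a) x ⟨
  sgnPow a * sgnPow a * x    ≡⟨ cong (_* x) (sgnPow-square a) ⟩
  1ℤ * x                     ≡⟨ ℤₚ.*-identityˡ x ⟩
  x                          ∎

sgnPow-∸ : ∀ n k → k ≤ n → sgnPow (n ∸ k) ≡ sgnPow n * sgnPow k
sgnPow-∸ n k k≤n = begin
  sgnPow (n ∸ k)                         ≡⟨ ℤₚ.*-identityʳ _ ⟨
  sgnPow (n ∸ k) * 1ℤ                    ≡⟨ cong (sgnPow (n ∸ k) *_) (sgnPow-square k) ⟨
  sgnPow (n ∸ k) * (sgnPow k * sgnPow k) ≡⟨ ℤₚ.*-assoc (sgnPow (n ∸ k)) _ _ ⟨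
  sgnPow (n ∸ k) * sgnPow k * sgnPow k   ≡⟨ cong (_* sgnPow k) (sgnPow-+ (n ∸ k) k) ⟨
  sgnPow (n ∸ k + k) * sgnPow k          ≡⟨ cong (λ m → sgnPow m * sgnPow k) (ℕₚ.m∸n+n≡m k≤n) ⟩
  sgnPow n * sgnPow k                    ∎

boolToℕ : Bool → ℕ
boolToℕ true  = 1
boolToℕ false = 0

sgnPow-<ᵇ-swap : ∀ a c → a ≢ c → sgnPow (boolToℕ (a <ᵇ c)) ≡ - sgnPow (boolToℕ (c <ᵇ a))
sgnPow-<ᵇ-swap zero    zero    a≢c = ⊥-elim (a≢c refl)
sgnPow-<ᵇ-swap zero    (suc c) a≢c = refl
sgnPow-<ᵇ-swap (suc a) zero    a≢c = refl
sgnPow-<ᵇ-swap (suc a) (suc c) a≢c = sgnPow-<ᵇ-swap a c (a≢c ∘′ cong suc)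

count : {A : Set} → (A → Bool) → List A → ℕ
count p xs = length (filterᵇ p xs)

module _ {A : Set} where

  count-∷ : ∀ (p : A → Bool) x xs → count p (x ∷ xs) ≡ boolToℕ (p x) + count p xs
  count-∷ p x xs with p x
  ... | true  = refl
  ... | false = refl

  count-++ : ∀ (p : A → Bool) xs ys → count p (xs ++ ys) ≡ count p xs + count p ys
  count-++ p []       ys = refl
  count-++ p (x ∷ xs) ys = begin
    count p (x ∷ xs ++ ys)                        ≡⟨ count-∷ p x (xs ++ ys) ⟩
    boolToℕ (p x) + count p (xs ++ ys)            ≡⟨ cong (boolToℕ (p x) ℕ.+_) (count-++ p xs ys) ⟩
    boolToℕ (p x) + (count p xs + count p ys)     ≡⟨ ℕₚ.+-assoc (boolToℕ (p x)) _ _ ⟨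
    boolToℕ (p x) + count p xs + count p ys       ≡⟨ cong (_+ count p ys) (count-∷ p x xs) ⟨
    count p (x ∷ xs) + count p ys                 ∎

  count-cong : ∀ (p q : A → Bool) xs → (∀ x → p x ≡ q x) → count p xs ≡ count q xs
  count-cong p q []       p≗q = refl
  count-cong p q (x ∷ xs) p≗q
    rewrite count-∷ p x xs | count-∷ q x xs | p≗q x | count-cong p q xs p≗q = refl

  count-false : ∀ xs → count (λ (_ : A) → false) xs ≡ 0
  count-false []       = refl
  count-false (x ∷ xs) = count-false xs

  count-true : ∀ xs → count (λ (_ : A) → true) xs ≡ length xs
  count-true []       = refl
  count-true (x ∷ xs) = cong suc (count-true xs)

count-map : {A B : Set} (p : B → Bool) (f : A → B) (xs : List A) →
            count p (map f xs) ≡ count (λ x → p (f x)) xs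
count-map p f []       = refl
count-map p f (x ∷ xs)
  rewrite count-∷ p (f x) (map f xs) | count-∷ (λ x → p (f x)) x xs | count-map p f xs = refl

inversions-map-monotone : (f : ℕ → ℕ) → (∀ a b → (f a <ᵇ f b) ≡ (a <ᵇ b)) →
                          ∀ xs → inversions (map f xs) ≡ inversions xs
inversions-map-monotone f mono []       = refl
inversions-map-monotone f mono (x ∷ xs) = cong₂ _+_
  (trans (count-map (_<ᵇ f x) f xs) (count-cong _ _ xs (λ y → mono y x)))
  (inversions-map-monotone f mono xs)

inversions-snoc : ∀ xs z → inversions (xs ++ [ z ]) ≡ inversions xs + count (z <ᵇ_) xs
inversions-snoc []       z = refl
inversions-snoc (x ∷ xs) z
  rewrite count-++ (_<ᵇ x) xs [ z ] | inversions-snoc xs z | count-∷ (z <ᵇ_) x xs | count-∷ (_<ᵇ x) z [] =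
  rearrange (count (_<ᵇ x) xs) (boolToℕ (z <ᵇ x)) (inversions xs) (count (z <ᵇ_) xs)
  where
  rearrange : ∀ a b i c → a + (b + 0) + (i + c) ≡ a + i + (b + c)
  rearrange = ℕ-Solver.solve-∀

<ᵇ-irrefl : ∀ a → (a <ᵇ a) ≡ false
<ᵇ-irrefl zero    = refl
<ᵇ-irrefl (suc a) = <ᵇ-irrefl a

≡ᵇ-refl : ∀ n → (n ≡ᵇ n) ≡ true
≡ᵇ-refl zero    = refl
≡ᵇ-refl (suc n) = ≡ᵇ-refl n

≢⇒≡ᵇ-false : ∀ m n → m ≢ n → (m ≡ᵇ n) ≡ false
≢⇒≡ᵇ-false zero    zero    m≢n = ⊥-elim (m≢n refl)
≢⇒≡ᵇ-false zero    (suc n) _   = refl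
≢⇒≡ᵇ-false (suc m) zero    _   = refl
≢⇒≡ᵇ-false (suc m) (suc n) m≢n = ≢⇒≡ᵇ-false m n (m≢n ∘′ cong suc)

punchInℕ : ℕ → ℕ → ℕ
punchInℕ zero    j       = suc j
punchInℕ (suc p) zero    = zero
punchInℕ (suc p) (suc j) = suc (punchInℕ p j)

punchInℕ-<ᵇ : ∀ p a b → (punchInℕ p a <ᵇ punchInℕ p b) ≡ (a <ᵇ b)
punchInℕ-<ᵇ zero    a       b       = refl
punchInℕ-<ᵇ (suc p) zero    zero    = refl
punchInℕ-<ᵇ (suc p) zero    (suc b) = refl
punchInℕ-<ᵇ (suc p) (suc a) zero    = refl
punchInℕ-<ᵇ (suc p) (suc a) (suc b) = punchInℕ-<ᵇ p a b

punchInℕ-<ᵇ-pivot : ∀ p j → (punchInℕ p j <ᵇ p) ≡ (j <ᵇ p)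
punchInℕ-<ᵇ-pivot zero    j       = refl
punchInℕ-<ᵇ-pivot (suc p) zero    = refl
punchInℕ-<ᵇ-pivot (suc p) (suc j) = punchInℕ-<ᵇ-pivot p j

-- Finite sums

∑ : {A : Set} → List A → (A → ℤ) → ℤ
∑ xs f = foldr (λ x acc → f x ℤ.+ acc) 0ℤ xs

syntax ∑ xs (λ x → e) = ∑[ x ∈ xs ] e

module _ {A : Set} where

  ∑-cong : ∀ (xs : List A) {f g : A → ℤ} → (∀ x → f x ≡ g x) → ∑ xs f ≡ ∑ xs g
  ∑-cong []       f≗g = refl
  ∑-cong (x ∷ xs) f≗g = cong₂ ℤ._+_ (f≗g x) (∑-cong xs f≗g)

  ∑-zero : ∀ (xs : List A) {f : A → ℤ} → (∀ x → f x ≡ 0ℤ) → ∑ xs f ≡ 0ℤ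
  ∑-zero []       f≗0 = refl
  ∑-zero (x ∷ xs) f≗0 = cong₂ ℤ._+_ (f≗0 x) (∑-zero xs f≗0)

  ∑-++ : ∀ (xs ys : List A) f → ∑ (xs ++ ys) f ≡ ∑ xs f ℤ.+ ∑ ys f
  ∑-++ []       ys f = sym (ℤₚ.+-identityˡ _)
  ∑-++ (x ∷ xs) ys f = trans (cong (λ s → f x ℤ.+ s) (∑-++ xs ys f)) (sym (ℤₚ.+-assoc (f x) _ _))

  ∑-*ʳ : ∀ (xs : List A) f c → ∑[ x ∈ xs ] (f x * c) ≡ ∑ xs f * c
  ∑-*ʳ []       f c = sym (ℤₚ.*-zeroˡ c)
  ∑-*ʳ (x ∷ xs) f c =
    trans (cong (λ s → f x * c ℤ.+ s) (∑-*ʳ xs f c)) (sym (ℤₚ.*-distribʳ-+ c (f x) _))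

  ∑-filter : ∀ (p : A → Bool) xs f → ∑ (filterᵇ p xs) f ≡ ∑[ x ∈ xs ] (if p x then f x else 0ℤ)
  ∑-filter p []       f = refl
  ∑-filter p (x ∷ xs) f with p x
  ... | true  = cong (λ s → f x ℤ.+ s) (∑-filter p xs f)
  ... | false = trans (∑-filter p xs f) (sym (ℤₚ.+-identityˡ _))

  ∑-indicator : ∀ (p : A → Bool) xs c → ∑[ x ∈ xs ] (if p x then c else 0ℤ) ≡ + count p xs * c
  ∑-indicator p []       c = sym (ℤₚ.*-zeroˡ c)
  ∑-indicator p (x ∷ xs) c rewrite count-∷ p x xs with p x
  ... | false = trans (ℤₚ.+-identityˡ _) (∑-indicator p xs c)
  ... | true  = begin
    c ℤ.+ ∑[ x ∈ xs ] (if p x then c else 0ℤ)  ≡⟨ cong (λ s → c ℤ.+ s) (∑-indicator p xs c) ⟩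
    c ℤ.+ + count p xs * c                      ≡⟨ cong (ℤ._+ + count p xs * c) (ℤₚ.*-identityˡ c) ⟨
    1ℤ * c ℤ.+ + count p xs * c                 ≡⟨ ℤₚ.*-distribʳ-+ c 1ℤ (+ count p xs) ⟨
    (1ℤ ℤ.+ + count p xs) * c                   ≡⟨ cong (_* c) (ℤₚ.pos-+ 1 (count p xs)) ⟨
    + suc (count p xs) * c                      ∎

∑-map : {A B : Set} (g : A → B) (xs : List A) (f : B → ℤ) → ∑ (map g xs) f ≡ ∑[ x ∈ xs ] f (g x)
∑-map g []       f = refl
∑-map g (x ∷ xs) f = cong (λ s → f (g x) ℤ.+ s) (∑-map g xs f)

∑-concatMap : {A B : Set} (g : A → List B) (xs : List A) (f : B → ℤ) →
              ∑ (concatMap g xs) f ≡ ∑[ x ∈ xs ] ∑ (g x) f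
∑-concatMap g []       f = refl
∑-concatMap g (x ∷ xs) f =
  trans (∑-++ (g x) (concatMap g xs) f) (cong (λ s → ∑ (g x) f ℤ.+ s) (∑-concatMap g xs f))

-- Lists without repetition

module Membership {V : Set} (_≟_ : DecidableEquality V) where

  _∈ᵇ_ : V → List V → Bool
  x ∈ᵇ xs = elem _≟_ x xs

  _∈_ _∉_ : V → List V → Set
  x ∈ xs = x ∈ᵇ xs ≡ true
  x ∉ xs = x ∈ᵇ xs ≡ false

  Nodup : List V → Set
  Nodup xs = nodup _≟_ xs ≡ true

  _⊆_ : List V → List V → Set
  xs ⊆ ys = ∀ y → y ∈ xs → y ∈ ys

  _⊆ᵇ_ : List V → List V → Bool
  []       ⊆ᵇ ys = true
  (x ∷ xs) ⊆ᵇ ys = x ∈ᵇ ys ∧ xs ⊆ᵇ ys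

  remove : V → List V → List V
  remove x []       = []
  remove x (y ∷ ys) = if does (x ≟ y) then ys else y ∷ remove x ys

  index : V → List V → ℕ
  index x []       = 0
  index x (y ∷ ys) = if does (x ≟ y) then 0 else suc (index x ys)

  ∈-here : ∀ x xs → x ∈ (x ∷ xs)
  ∈-here x xs with x ≟ x
  ... | yes _  = refl
  ... | no x≢x = ⊥-elim (x≢x refl)

  ∈-there : ∀ x {y} xs → y ∈ xs → y ∈ (x ∷ xs)
  ∈-there x {y} xs y∈xs with y ≟ x
  ... | yes _ = refl
  ... | no _  = y∈xs

  ∈∧∉⇒≢ : ∀ {x y} xs → y ∈ xs → x ∉ xs → y ≢ x
  ∈∧∉⇒≢ xs y∈xs x∉xs refl with trans (sym y∈xs) x∉xs
  ... | ()

  ∈ᵇ-++ : ∀ y xs ys → y ∈ᵇ (xs ++ ys) ≡ y ∈ᵇ xs ∨ y ∈ᵇ ys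
  ∈ᵇ-++ y []       ys = refl
  ∈ᵇ-++ y (x ∷ xs) ys with y ≟ x
  ... | yes _ = refl
  ... | no _  = ∈ᵇ-++ y xs ys

  nodup-∷⁻ : ∀ {x} xs → Nodup (x ∷ xs) → x ∉ xs × Nodup xs
  nodup-∷⁻ {x} xs h with x ∈ᵇ xs | nodup _≟_ xs
  ... | false | true = refl , refl

  nodup-∷⁺ : ∀ {x} xs → x ∉ xs → Nodup xs → Nodup (x ∷ xs)
  nodup-∷⁺ xs x∉xs nodup-xs rewrite x∉xs | nodup-xs = refl

  nodup-snoc : ∀ σ x → Nodup σ → nodup _≟_ (σ ++ [ x ]) ≡ not (x ∈ᵇ σ)
  nodup-snoc []      x _ = refl
  nodup-snoc (y ∷ σ) x h
    rewrite nodup-snoc σ x (proj₂ (nodup-∷⁻ σ h)) | ∈ᵇ-++ y σ [ x ] | proj₁ (nodup-∷⁻ σ h)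
    with y ≟ x | x ≟ y
  ... | yes _    | yes _    = refl
  ... | no _     | no _     = refl
  ... | yes refl | no y≢y   = ⊥-elim (y≢y refl)
  ... | no y≢y   | yes refl = ⊥-elim (y≢y refl)

  ∈-remove⁻ : ∀ x {y} xs → y ∈ remove x xs → y ∈ xs
  ∈-remove⁻ x {y} (z ∷ xs) h with x ≟ z
  ... | yes refl = ∈-there x xs h
  ... | no _ with y ≟ z
  ...   | yes _ = refl
  ...   | no _  = ∈-remove⁻ x xs h

  ∉-remove : ∀ x {y} xs → y ∉ xs → y ∉ remove x xs
  ∉-remove x {y} xs y∉xs with y ∈ᵇ remove x xs in eq
  ... | false = refl
  ... | true  = trans (sym (∈-remove⁻ x xs eq)) y∉xs

  ∈-remove⁺ : ∀ x {y} xs → y ≢ x → y ∈ xs → y ∈ remove x xs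
  ∈-remove⁺ x {y} (z ∷ xs) y≢x h with x ≟ z
  ... | yes refl with y ≟ x
  ...   | yes y≡x = ⊥-elim (y≢x y≡x)
  ...   | no _    = h
  ∈-remove⁺ x {y} (z ∷ xs) y≢x h | no _ with y ≟ z
  ...   | yes _ = refl
  ...   | no _  = ∈-remove⁺ x xs y≢x h

  ∉-remove-self : ∀ x xs → Nodup xs → x ∉ remove x xs
  ∉-remove-self x []       _ = refl
  ∉-remove-self x (z ∷ xs) h with x ≟ z
  ... | yes refl = proj₁ (nodup-∷⁻ xs h)
  ... | no x≢z with x ≟ z
  ...   | yes x≡z = ⊥-elim (x≢z x≡z)
  ...   | no _    = ∉-remove-self x xs (proj₂ (nodup-∷⁻ xs h))

  ∈ᵇ-remove : ∀ x y xs → Nodup xs → y ∈ᵇ remove x xs ≡ not (does (x ≟ y)) ∧ y ∈ᵇ xs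
  ∈ᵇ-remove x y xs h with x ≟ y
  ... | yes refl = ∉-remove-self x xs h
  ... | no x≢y with y ∈ᵇ xs in eq
  ...   | true  = ∈-remove⁺ x xs (x≢y ∘′ sym) eq
  ...   | false = ∉-remove x xs eq

  nodup-remove : ∀ x xs → Nodup xs → Nodup (remove x xs)
  nodup-remove x []       _ = refl
  nodup-remove x (z ∷ xs) h with x ≟ z
  ... | yes _ = proj₂ (nodup-∷⁻ xs h)
  ... | no _  = nodup-∷⁺ (remove x xs) (∉-remove x xs (proj₁ (nodup-∷⁻ xs h)))
                         (nodup-remove x xs (proj₂ (nodup-∷⁻ xs h)))

  length-remove : ∀ {x} xs → x ∈ xs → suc (length (remove x xs)) ≡ length xs
  length-remove {x} (z ∷ xs) h with x ≟ z
  ... | yes _ = refl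
  ... | no _  = cong suc (length-remove xs h)

  count-remove : ∀ (p : V → Bool) {x} xs → x ∈ xs → count p xs ≡ boolToℕ (p x) + count p (remove x xs)
  count-remove p {x} (z ∷ xs) h with x ≟ z
  ... | yes refl = count-∷ p x xs
  ... | no _ = begin
    count p (z ∷ xs)                      ≡⟨ count-∷ p z xs ⟩
    [z] + count p xs                      ≡⟨ cong ([z] ℕ.+_) (count-remove p xs h) ⟩
    [z] + ([x] + count p (remove x xs))   ≡⟨ x∙yz≈y∙xz [z] [x] _ ⟩
    [x] + ([z] + count p (remove x xs))   ≡⟨ cong ([x] ℕ.+_) (count-∷ p z (remove x xs)) ⟨
    [x] + count p (z ∷ remove x xs)       ∎
    where
    [x] = boolToℕ (p x)
    [z] = boolToℕ (p z)

  length-remove-tail : ∀ {x} s t → x ∈ t → length (x ∷ s) ≡ length t → length s ≡ length (remove x t)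
  length-remove-tail s t x∈t |xs|≡|t| = ℕₚ.suc-injective (trans |xs|≡|t| (sym (length-remove t x∈t)))

  count-remove-false : ∀ (p : V → Bool) {x} xs → p x ≡ false → x ∈ xs → count p xs ≡ count p (remove x xs)
  count-remove-false p {x} xs px≡false x∈xs =
    trans (count-remove p xs x∈xs) (cong (λ b → boolToℕ b + count p (remove x xs)) px≡false)

  ⊆-remove : ∀ x s t → Nodup (x ∷ s) → (x ∷ s) ⊆ t → s ⊆ remove x t
  ⊆-remove x s t nodup-xs xs⊆t y y∈s =
    ∈-remove⁺ x t (∈∧∉⇒≢ s y∈s (proj₁ (nodup-∷⁻ s nodup-xs))) (xs⊆t y (∈-there x s y∈s))

  ⊆ᵇ⇒⊆ : ∀ s t → s ⊆ᵇ t ≡ true → s ⊆ t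
  ⊆ᵇ⇒⊆ (x ∷ s) t h y y∈xs with x ∈ᵇ t in x∈t | s ⊆ᵇ t in s⊆t
  ⊆ᵇ⇒⊆ (x ∷ s) t refl y y∈xs | true | true with y ≟ x
  ... | yes refl = x∈t
  ... | no _     = ⊆ᵇ⇒⊆ s t s⊆t y y∈xs

  ⊆⇒⊆ᵇ : ∀ s t → s ⊆ t → s ⊆ᵇ t ≡ true
  ⊆⇒⊆ᵇ []      t h = refl
  ⊆⇒⊆ᵇ (x ∷ s) t h rewrite h x (∈-here x s) = ⊆⇒⊆ᵇ s t (λ y y∈s → h y (∈-there x s y∈s))

  ∉-or-⊆ᵇ : ∀ xs t → (∃[ k ] k ∉ t) ⊎ xs ⊆ᵇ t ≡ true
  ∉-or-⊆ᵇ []       t = inj₂ refl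
  ∉-or-⊆ᵇ (x ∷ xs) t with x ∈ᵇ t in x∈t
  ... | false = inj₁ (x , x∈t)
  ... | true  = ∉-or-⊆ᵇ xs t

  ⊆ᵇ-remove : ∀ x s t → Nodup t → s ⊆ᵇ remove x t ≡ not (x ∈ᵇ s) ∧ s ⊆ᵇ t
  ⊆ᵇ-remove x []      t _ = refl
  ⊆ᵇ-remove x (z ∷ s) t h
    rewrite ∈ᵇ-remove x z t h | ⊆ᵇ-remove x s t h = regroup (does (x ≟ z)) (z ∈ᵇ t) (x ∈ᵇ s) (s ⊆ᵇ t)
    where
    regroup : ∀ a b c d → (not a ∧ b) ∧ (not c ∧ d) ≡ not (a ∨ c) ∧ (b ∧ d)
    regroup true  b     c     d = refl
    regroup false true  c     d = refl
    regroup false false true  d = refl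
    regroup false false false d = refl

  count-⊆ : ∀ (p : V → Bool) s t → Nodup s → length s ≡ length t → s ⊆ t → count p s ≡ count p t
  count-⊆ p []      []  _  _  _  = refl
  count-⊆ p (x ∷ s) t h |xs|≡|t| xs⊆t = begin
    count p (x ∷ s)                        ≡⟨ count-∷ p x s ⟩
    boolToℕ (p x) + count p s              ≡⟨ cong (boolToℕ (p x) ℕ.+_)
                                                 (count-⊆ p s (remove x t) (proj₂ (nodup-∷⁻ s h))
                                                   (length-remove-tail s t x∈t |xs|≡|t|) (⊆-remove x s t h xs⊆t)) ⟩
    boolToℕ (p x) + count p (remove x t)   ≡⟨ count-remove p t x∈t ⟨
    count p t                              ∎
    where x∈t = xs⊆t x (∈-here x s)

  ⊆-flip : ∀ s t → Nodup s → length s ≡ length t → s ⊆ t → t ⊆ s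
  ⊆-flip []      []  _ _ _ y ()
  ⊆-flip (x ∷ s) t h |xs|≡|t| xs⊆t y y∈t with y ≟ x
  ... | yes _   = refl
  ... | no y≢x  = ⊆-flip s (remove x t) (proj₂ (nodup-∷⁻ s h)) (length-remove-tail s t x∈t |xs|≡|t|)
                    (⊆-remove x s t h xs⊆t) y (∈-remove⁺ x t y≢x y∈t)
    where x∈t = xs⊆t x (∈-here x s)

  length-⊆ : ∀ s t → Nodup s → s ⊆ t → length s ≤ length t
  length-⊆ []      t _ _   = z≤n
  length-⊆ (x ∷ s) t h s⊆t = subst (suc (length s) ≤_) (length-remove t x∈t)
    (s≤s (length-⊆ s (remove x t) (proj₂ (nodup-∷⁻ s h)) (⊆-remove x s t h s⊆t)))
    where x∈t = s⊆t x (∈-here x s)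

  count-cong-∈ : ∀ (p q : V → Bool) xs → (∀ x → x ∈ xs → p x ≡ q x) → count p xs ≡ count q xs
  count-cong-∈ p q []       _   = refl
  count-cong-∈ p q (x ∷ xs) p≗q rewrite count-∷ p x xs | count-∷ q x xs | p≗q x (∈-here x xs)
    | count-cong-∈ p q xs (λ y y∈xs → p≗q y (∈-there x xs y∈xs)) = refl

  map-cong-∈ : {B : Set} (f g : V → B) (xs : List V) → (∀ x → x ∈ xs → f x ≡ g x) → map f xs ≡ map g xs
  map-cong-∈ f g []       _   = refl
  map-cong-∈ f g (x ∷ xs) f≗g =
    cong₂ _∷_ (f≗g x (∈-here x xs)) (map-cong-∈ f g xs (λ y y∈xs → f≗g y (∈-there x xs y∈xs)))

  ∑-zero-∈ : ∀ xs (f : V → ℤ) → (∀ x → x ∈ xs → f x ≡ 0ℤ) → ∑ xs f ≡ 0ℤ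
  ∑-zero-∈ []       f _   = refl
  ∑-zero-∈ (x ∷ xs) f f≗0 =
    cong₂ ℤ._+_ (f≗0 x (∈-here x xs)) (∑-zero-∈ xs f (λ y y∈xs → f≗0 y (∈-there x xs y∈xs)))

  ∑-single : ∀ xs k (g : V → ℤ) → Nodup xs → k ∈ xs →
             ∑[ x ∈ xs ] (if does (x ≟ k) then g x else 0ℤ) ≡ g k
  ∑-single (x ∷ xs) k g h k∈xs with x ≟ k
  ... | yes refl = trans (cong (λ s → g x ℤ.+ s) (∑-zero-∈ xs _ others)) (ℤₚ.+-identityʳ (g x))
    where
    others : ∀ y → y ∈ xs → (if does (y ≟ x) then g y else 0ℤ) ≡ 0ℤ
    others y y∈xs with y ≟ x
    ... | no _    = refl
    ... | yes y≡x = ⊥-elim (∈∧∉⇒≢ xs y∈xs (proj₁ (nodup-∷⁻ xs h)) y≡x)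
  ... | no x≢k = trans (ℤₚ.+-identityˡ _) (∑-single xs k g (proj₂ (nodup-∷⁻ xs h)) k∈xs')
    where
    k∈xs' : k ∈ xs
    k∈xs' with k ≟ x
    ... | yes k≡x = ⊥-elim (x≢k (sym k≡x))
    ... | no _    = k∈xs

  ∈-filter⁻ : ∀ (p : V → Bool) {y} xs → y ∈ filterᵇ p xs → p y ≡ true × y ∈ xs
  ∈-filter⁻ p {y} (z ∷ xs) h with p z in pz
  ... | false = let (py , y∈xs) = ∈-filter⁻ p xs h in py , ∈-there z xs y∈xs
  ... | true with y ≟ z
  ...   | yes refl = pz , refl
  ...   | no _     = ∈-filter⁻ p xs h

  ∈-filter⁺ : ∀ (p : V → Bool) {y} xs → y ∈ xs → p y ≡ true → y ∈ filterᵇ p xs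
  ∈-filter⁺ p {y} (z ∷ xs) y∈xs py with y ≟ z
  ∈-filter⁺ p {y} (z ∷ xs) y∈xs py | yes refl rewrite py = ∈-here y (filterᵇ p xs)
  ∈-filter⁺ p {y} (z ∷ xs) y∈xs py | no _ with p z
  ... | false = ∈-filter⁺ p xs y∈xs py
  ... | true  = ∈-there z (filterᵇ p xs) (∈-filter⁺ p xs y∈xs py)

  ∉-filter : ∀ (p : V → Bool) {y} xs → y ∉ xs → y ∉ filterᵇ p xs
  ∉-filter p {y} xs y∉xs with y ∈ᵇ filterᵇ p xs in eq
  ... | false = refl
  ... | true  = trans (sym (proj₂ (∈-filter⁻ p xs eq))) y∉xs

  nodup-filter : ∀ (p : V → Bool) xs → Nodup xs → Nodup (filterᵇ p xs)
  nodup-filter p []       _ = refl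
  nodup-filter p (z ∷ xs) h with p z
  ... | false = nodup-filter p xs (proj₂ (nodup-∷⁻ xs h))
  ... | true  = nodup-∷⁺ (filterᵇ p xs) (∉-filter p xs (proj₁ (nodup-∷⁻ xs h)))
                         (nodup-filter p xs (proj₂ (nodup-∷⁻ xs h)))

  count-∈ᵇ : ∀ t ys → Nodup t → Nodup ys → t ⊆ ys → count (_∈ᵇ t) ys ≡ length t
  count-∈ᵇ t ys nodup-t nodup-ys t⊆ys = ℕₚ.≤-antisym
    (length-⊆ (filterᵇ (_∈ᵇ t) ys) t (nodup-filter (_∈ᵇ t) ys nodup-ys)
              (λ y h → proj₁ (∈-filter⁻ (_∈ᵇ t) ys h)))
    (length-⊆ t (filterᵇ (_∈ᵇ t) ys) nodup-t
              (λ y y∈t → ∈-filter⁺ (_∈ᵇ t) ys (t⊆ys y y∈t) y∈t))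

  _≢ᵇ_ : V → V → Bool
  j ≢ᵇ i = not (does (j ≟ i))

  filter-≢ᵇ-∉ : ∀ i xs → i ∉ xs → filterᵇ (_≢ᵇ i) xs ≡ xs
  filter-≢ᵇ-∉ i []       _   = refl
  filter-≢ᵇ-∉ i (z ∷ xs) i∉zxs with z ≟ i
  ... | yes refl = ⊥-elim (∈∧∉⇒≢ (z ∷ xs) (∈-here z xs) i∉zxs refl)
  ... | no z≢i with i ≟ z
  ...   | yes i≡z = ⊥-elim (z≢i (sym i≡z))
  ...   | no _    = cong (z ∷_) (filter-≢ᵇ-∉ i xs i∉zxs)

  filter-≢ᵇ-remove : ∀ i xs → Nodup xs → filterᵇ (_≢ᵇ i) xs ≡ remove i xs
  filter-≢ᵇ-remove i []       _ = refl
  filter-≢ᵇ-remove i (z ∷ xs) h with z ≟ i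
  ... | yes refl with z ≟ z
  ...   | yes _   = filter-≢ᵇ-∉ z xs (proj₁ (nodup-∷⁻ xs h))
  ...   | no z≢z  = ⊥-elim (z≢z refl)
  filter-≢ᵇ-remove i (z ∷ xs) h | no z≢i with i ≟ z
  ...   | yes i≡z = ⊥-elim (z≢i (sym i≡z))
  ...   | no _    = cong (z ∷_) (filter-≢ᵇ-remove i xs (proj₂ (nodup-∷⁻ xs h)))

  index-remove : ∀ x y t → x ∈ t → y ≢ x → index y t ≡ punchInℕ (index x t) (index y (remove x t))
  index-remove x y (z ∷ t) x∈t y≢x with x ≟ z
  ... | yes refl with y ≟ x
  ...   | yes y≡x = ⊥-elim (y≢x y≡x)
  ...   | no _    = refl
  index-remove x y (z ∷ t) x∈t y≢x | no _ with y ≟ z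
  ...   | yes _ = refl
  ...   | no _  = cong suc (index-remove x y t x∈t y≢x)

  index<length : ∀ x t → x ∈ t → index x t < length t
  index<length x (z ∷ t) x∈t with x ≟ z
  ... | yes _ = s≤s z≤n
  ... | no _  = s≤s (index<length x t x∈t)

  count-index< : ∀ u p → Nodup u → p ≤ length u → count (λ y → index y u <ᵇ p) u ≡ p
  count-index< u       zero    _ _ = count-false u
  count-index< (y ∷ u) (suc p) h (s≤s p≤|u|) rewrite count-∷ (λ z → index z (y ∷ u) <ᵇ suc p) y u
    with y ≟ y
  ... | no y≢y = ⊥-elim (y≢y refl)
  ... | yes _  =
    cong suc (trans (count-cong-∈ _ _ u shifted) (count-index< u p (proj₂ (nodup-∷⁻ u h)) p≤|u|))
    where
    shifted : ∀ z → z ∈ u → (index z (y ∷ u) <ᵇ suc p) ≡ (index z u <ᵇ p)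
    shifted z z∈u with z ≟ y
    ... | no _    = refl
    ... | yes z≡y = ⊥-elim (∈∧∉⇒≢ u z∈u (proj₁ (nodup-∷⁻ u h)) z≡y)

  pos-∈ : ∀ x t → x ∈ t → pos _≟_ x t ≡ just (index x t)
  pos-∈ x (z ∷ t) x∈t with x ≟ z
  ... | yes _ = refl
  ... | no _ rewrite pos-∈ x t x∈t = refl

  pos-∉ : ∀ x t → x ∉ t → pos _≟_ x t ≡ nothing
  pos-∉ x []       _   = refl
  pos-∉ x (z ∷ t) x∉t with x ≟ z
  pos-∉ x (z ∷ t) () | yes _
  ... | no _ rewrite pos-∉ x t x∉t = refl

  positions-⊆ : ∀ s t → s ⊆ᵇ t ≡ true → positions _≟_ s t ≡ just (map (λ v → index v t) s)
  positions-⊆ []      t _ = refl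
  positions-⊆ (x ∷ s) t h with x ∈ᵇ t in x∈t | s ⊆ᵇ t in s⊆t
  positions-⊆ (x ∷ s) t refl | true | true rewrite pos-∈ x t x∈t | positions-⊆ s t s⊆t = refl

  positions-⊈ : ∀ s t → s ⊆ᵇ t ≡ false → positions _≟_ s t ≡ nothing
  positions-⊈ (x ∷ s) t h with x ∈ᵇ t in x∈t
  ... | false rewrite pos-∉ x t x∈t = refl
  ... | true with pos _≟_ x t
  ...   | nothing = refl
  ...   | just _ rewrite positions-⊈ s t h = refl

  rel-¬nodupʳ : ∀ s t → nodup _≟_ t ≡ false → rel _≟_ s t ≡ 0ℤ
  rel-¬nodupʳ s t h with nodup _≟_ s
  ... | false = refl
  ... | true rewrite h = refl

  rel-length≢ : ∀ s t → length s ≢ length t → rel _≟_ s t ≡ 0ℤ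
  rel-length≢ s t h rewrite ≢⇒≡ᵇ-false _ _ h with nodup _≟_ s | nodup _≟_ t
  ... | false | _     = refl
  ... | true  | false = refl
  ... | true  | true  = refl

  rel-same-length : ∀ s t → Nodup t → length s ≡ length t →
    rel _≟_ s t ≡ (if nodup _≟_ s ∧ s ⊆ᵇ t then sgnPow (inversions (map (λ v → index v t) s)) else 0ℤ)
  rel-same-length s t nodup-t |s|≡|t| with nodup _≟_ s | s ⊆ᵇ t in s⊆t
  ... | false | _     = refl
  ... | true  | true  rewrite nodup-t | |s|≡|t| | ≡ᵇ-refl (length t) | positions-⊆ s t s⊆t = refl
  ... | true  | false rewrite nodup-t | |s|≡|t| | ≡ᵇ-refl (length t) | positions-⊈ s t s⊆t = refl

open module FinMembership {n : ℕ} = Membership (_≟_ {n})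

allFin-suc : ∀ n → allFin (suc n) ≡ fzero ∷ map fsuc (allFin n)
allFin-suc n = cong (fzero ∷_) (sym (map-tabulate (λ i → i) fsuc))

length-allFin : ∀ n → length (allFin n) ≡ n
length-allFin n = length-tabulate (λ i → i)

∈ᵇ-map-fsuc : ∀ {n} (y : Fin n) xs → fsuc y ∈ᵇ map fsuc xs ≡ y ∈ᵇ xs
∈ᵇ-map-fsuc y []       = refl
∈ᵇ-map-fsuc y (z ∷ xs) = cong (does (y ≟ z) ∨_) (∈ᵇ-map-fsuc y xs)

fzero-∉-map-fsuc : ∀ {n} (xs : List (Fin n)) → fzero ∉ map fsuc xs
fzero-∉-map-fsuc []       = refl
fzero-∉-map-fsuc (z ∷ xs) = fzero-∉-map-fsuc xs

nodup-map-fsuc : ∀ {n} (xs : List (Fin n)) → nodup _≟_ (map fsuc xs) ≡ nodup _≟_ xs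
nodup-map-fsuc []       = refl
nodup-map-fsuc (z ∷ xs) rewrite ∈ᵇ-map-fsuc z xs | nodup-map-fsuc xs = refl

∈-allFin : ∀ n (y : Fin n) → y ∈ allFin n
∈-allFin (suc n) fzero    = refl
∈-allFin (suc n) (fsuc y) = begin
  fsuc y ∈ᵇ allFin (suc n)              ≡⟨ cong (fsuc y ∈ᵇ_) (allFin-suc n) ⟩
  fsuc y ∈ᵇ (fzero ∷ map fsuc (allFin n)) ≡⟨ ∈ᵇ-map-fsuc y (allFin n) ⟩
  y ∈ᵇ allFin n                          ≡⟨ ∈-allFin n y ⟩
  true                                   ∎

nodup-allFin : ∀ n → Nodup (allFin n)
nodup-allFin zero    = refl
nodup-allFin (suc n) = subst Nodup (sym (allFin-suc n))
  (nodup-∷⁺ (map fsuc (allFin n)) (fzero-∉-map-fsuc (allFin n)) (trans (nodup-map-fsuc (allFin n)) (nodup-allFin n)))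

count-allFin-> : ∀ n (k : Fin (suc n)) → count (λ y → toℕ k <ᵇ toℕ y) (allFin (suc n)) ≡ n ∸ toℕ k
count-allFin-> n k = begin
  count (k <ᶠ_) (allFin (suc n))
    ≡⟨ cong (count (k <ᶠ_)) (allFin-suc n) ⟩
  count (k <ᶠ_) (fzero ∷ map fsuc (allFin n))
    ≡⟨ count-∷ (k <ᶠ_) fzero (map fsuc (allFin n)) ⟩
  boolToℕ (k <ᶠ fzero) + count (k <ᶠ_) (map fsuc (allFin n))
    ≡⟨ cong (boolToℕ (k <ᶠ fzero) ℕ.+_) (count-map (k <ᶠ_) fsuc (allFin n)) ⟩
  boolToℕ (k <ᶠ fzero) + count (λ y → k <ᶠ fsuc y) (allFin n)
    ≡⟨ split-first n k ⟩
  n ∸ toℕ k ∎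
  where
  _<ᶠ_ : Fin (suc n) → Fin (suc n) → Bool
  k <ᶠ y = toℕ k <ᵇ toℕ y
  split-first : ∀ m (k : Fin (suc m)) →
                boolToℕ (toℕ k <ᵇ 0) + count (λ y → toℕ k <ᵇ suc (toℕ y)) (allFin m) ≡ m ∸ toℕ k
  split-first m       fzero    = trans (count-true (allFin m)) (length-allFin m)
  split-first (suc m) (fsuc k) = count-allFin-> m k

filterᵇ-map-fsuc : ∀ {n} (p : Fin (suc n) → Bool) (xs : List (Fin n)) →
                   filterᵇ p (map fsuc xs) ≡ map fsuc (filterᵇ (λ x → p (fsuc x)) xs)
filterᵇ-map-fsuc p []       = refl
filterᵇ-map-fsuc p (z ∷ xs) with p (fsuc z)
... | true  = cong (fsuc z ∷_) (filterᵇ-map-fsuc p xs)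
... | false = filterᵇ-map-fsuc p xs

sgn-map-fsuc : ∀ {n} (xs : List (Fin n)) → sgn (map fsuc xs) ≡ sgn xs
sgn-map-fsuc xs = cong sgnPow (trans (cong inversions (trans (sym (map-∘ xs)) (map-∘ xs)))
                                     (inversions-map-monotone suc (λ _ _ → refl) (map toℕ xs)))

sgn-filterᵇ-allFin : ∀ n (p : Fin n → Bool) → sgn (filterᵇ p (allFin n)) ≡ 1ℤ
sgn-filterᵇ-allFin zero    p = refl
sgn-filterᵇ-allFin (suc n) p = trans (cong (λ xs → sgn (filterᵇ p xs)) (allFin-suc n)) split
  where
  rest = filterᵇ (λ x → p (fsuc x)) (allFin n)
  sgn-tail : sgn (filterᵇ p (map fsuc (allFin n))) ≡ 1ℤ
  sgn-tail = trans (cong sgn (filterᵇ-map-fsuc p (allFin n)))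
                   (trans (sgn-map-fsuc rest) (sgn-filterᵇ-allFin n _))
  split : sgn (filterᵇ p (fzero ∷ map fsuc (allFin n))) ≡ 1ℤ
  split with p fzero
  ... | false = sgn-tail
  ... | true  = trans (sgnPow-+ (count (_<ᵇ 0) (map toℕ tl)) (inversions (map toℕ tl)))
                      (cong₂ _*_ (cong sgnPow (count-false (map toℕ tl))) sgn-tail)
    where tl = filterᵇ p (map fsuc (allFin n))

-- The sign of a rearrangement

#below : ∀ {r} → Fin r → List (Fin r) → ℕ
#below x t = count (_<ᵇ toℕ x) (map toℕ t)

#below-∷-self : ∀ {r} (x : Fin r) t → #below x (x ∷ t) ≡ #below x t
#below-∷-self x t = trans (count-∷ (_<ᵇ toℕ x) (toℕ x) (map toℕ t))
                          (cong (λ b → boolToℕ b + #below x t) (<ᵇ-irrefl (toℕ x)))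

-- Deleting x from position p of t destroys p + #below x t inversions, up to an even number.
sgn-remove : ∀ {r} (x : Fin r) t → x ∈ t → sgn t ≡ sgn (remove x t) * sgnPow (index x t) * sgnPow (#below x t)
sgn-remove x (z ∷ t) x∈t with x ≟ z
... | yes refl = begin
  sgnPow (#below x t + I)                   ≡⟨ sgnPow-+ (#below x t) I ⟩
  sgnPow (#below x t) * sgnPow I            ≡⟨ swap (sgnPow (#below x t)) (sgnPow I) ⟩
  sgnPow I * 1ℤ * sgnPow (#below x t)       ≡⟨ cong (λ m → sgnPow I * 1ℤ * sgnPow m) (#below-∷-self x t) ⟨
  sgnPow I * 1ℤ * sgnPow (#below x (x ∷ t)) ∎
  where
  I = inversions (map toℕ t)
  swap : ∀ u v → u * v ≡ v * 1ℤ * u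
  swap = solve-∀
... | no x≢z = begin
  S (CL + IL)
    ≡⟨ sgnPow-+ CL IL ⟩
  S CL * S IL
    ≡⟨ cong₂ _*_ (cong S CL≡) (sgn-remove x t x∈t) ⟩
  S ([a<c] + CR) * (S IR * S P * S K)
    ≡⟨ cong (_* (S IR * S P * S K)) (sgnPow-+ [a<c] CR) ⟩
  S [a<c] * S CR * (S IR * S P * S K)
    ≡⟨ cong (λ u → u * S CR * (S IR * S P * S K)) (sgnPow-<ᵇ-swap a c (x≢z ∘′ toℕ-injective)) ⟩
  - S [c<a] * S CR * (S IR * S P * S K)
    ≡⟨ regroup (S [c<a]) (S CR) (S IR) (S P) (S K) ⟩
  S CR * S IR * (-1ℤ * S P) * (S [c<a] * S K)
    ≡⟨ cong₂ (λ u v → u * (-1ℤ * S P) * v) (sgnPow-+ CR IR) (sgnPow-+ [c<a] K) ⟨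
  S (CR + IR) * (-1ℤ * S P) * S ([c<a] + K)
    ≡⟨ cong (λ m → S (CR + IR) * (-1ℤ * S P) * S m) (count-∷ (_<ᵇ a) c (map toℕ t)) ⟨
  S (CR + IR) * (-1ℤ * S P) * S (#below x (z ∷ t)) ∎
  where
  S = sgnPow
  a = toℕ x
  c = toℕ z
  [a<c] = boolToℕ (a <ᵇ c)
  [c<a] = boolToℕ (c <ᵇ a)
  CL = count (_<ᵇ c) (map toℕ t)
  IL = inversions (map toℕ t)
  CR = count (_<ᵇ c) (map toℕ (remove x t))
  IR = inversions (map toℕ (remove x t))
  P = index x t
  K = #below x t
  CL≡ : CL ≡ [a<c] + CR
  CL≡ = begin
    CL                                             ≡⟨ count-map (_<ᵇ c) toℕ t ⟩
    count (λ y → toℕ y <ᵇ c) t                     ≡⟨ count-remove (λ y → toℕ y <ᵇ c) t x∈t ⟩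
    [a<c] + count (λ y → toℕ y <ᵇ c) (remove x t)  ≡⟨ cong ([a<c] ℕ.+_) (count-map (_<ᵇ c) toℕ (remove x t)) ⟨
    [a<c] + CR                                     ∎
  regroup : ∀ b cr ir p k → - b * cr * (ir * p * k) ≡ cr * ir * (-1ℤ * p) * (b * k)
  regroup = solve-∀

-- Deleting the head x of s from t shifts the positions of the other entries of s by punchInℕ (index x t).
sgn-index-rearrangement : ∀ {r} (s t : List (Fin r)) → Nodup s → Nodup t → length s ≡ length t → s ⊆ t →
                          sgnPow (inversions (map (λ v → index v t) s)) ≡ sgn s * sgn t
sgn-index-rearrangement []      []  _ _ _ _ = refl
sgn-index-rearrangement (x ∷ s) t nodup-xs nodup-t |xs|≡|t| xs⊆t = begin
  sgnPow (count (_<ᵇ p) (map (λ v → index v t) s) + inversions (map (λ v → index v t) s))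
    ≡⟨ cong (λ l → sgnPow (count (_<ᵇ p) l + inversions l)) positions-shift ⟩
  sgnPow (count (_<ᵇ p) (map (punchInℕ p) M) + inversions (map (punchInℕ p) M))
    ≡⟨ cong₂ (λ u v → sgnPow (u + v)) count-below-p
             (inversions-map-monotone (punchInℕ p) (punchInℕ-<ᵇ p) M) ⟩
  sgnPow (p + inversions M)
    ≡⟨ sgnPow-+ p _ ⟩
  sgnPow p * sgnPow (inversions M)
    ≡⟨ cong (sgnPow p *_) (sgn-index-rearrangement s u nodup-s nodup-u |s|≡|u| s⊆u) ⟩
  sgnPow p * (sgn s * sgn u)
    ≡⟨ sgnPow-cancelˡ b _ ⟨
  sgnPow b * (sgnPow b * (sgnPow p * (sgn s * sgn u)))
    ≡⟨ regroup (sgnPow b) (sgnPow p) (sgn s) (sgn u) ⟩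
  (sgnPow b * sgn s) * (sgn u * sgnPow p * sgnPow b)
    ≡⟨ cong₂ _*_ (sgnPow-+ b _)
             (trans (sgn-remove x t x∈t) (cong (λ m → sgn u * sgnPow p * sgnPow m) #below-t)) ⟨
  sgn (x ∷ s) * sgn t ∎
  where
  x∈t = xs⊆t x (∈-here x s)
  u = remove x t
  p = index x t
  M = map (λ v → index v u) s
  b = count (_<ᵇ toℕ x) (map toℕ s)
  nodup-s = proj₂ (nodup-∷⁻ s nodup-xs)
  nodup-u = nodup-remove x t nodup-t
  |s|≡|u| = length-remove-tail s t x∈t |xs|≡|t|
  s⊆u = ⊆-remove x s t nodup-xs xs⊆t
  positions-shift : map (λ v → index v t) s ≡ map (punchInℕ p) M
  positions-shift = trans (map-cong-∈ _ (λ v → punchInℕ p (index v u)) s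
                     (λ v v∈s → index-remove x v t x∈t (∈∧∉⇒≢ s v∈s (proj₁ (nodup-∷⁻ s nodup-xs)))))
                   (map-∘ s)
  p≤|u| : p ≤ length u
  p≤|u| = ℕₚ.≤-pred (subst (suc p ≤_) (sym (length-remove t x∈t)) (index<length x t x∈t))
  count-below-p : count (_<ᵇ p) (map (punchInℕ p) M) ≡ p
  count-below-p = begin
    count (_<ᵇ p) (map (punchInℕ p) M)  ≡⟨ count-map _ (punchInℕ p) M ⟩
    count (λ j → punchInℕ p j <ᵇ p) M   ≡⟨ count-cong _ _ M (punchInℕ-<ᵇ-pivot p) ⟩
    count (_<ᵇ p) M                     ≡⟨ count-map _ (λ v → index v u) s ⟩
    count (λ v → index v u <ᵇ p) s      ≡⟨ count-⊆ _ s u nodup-s |s|≡|u| s⊆u ⟩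
    count (λ v → index v u <ᵇ p) u      ≡⟨ count-index< u p nodup-u p≤|u| ⟩
    p                                   ∎
  #below-t : #below x t ≡ b
  #below-t = begin
    #below x t                      ≡⟨ count-map _ toℕ t ⟩
    count (λ y → toℕ y <ᵇ toℕ x) t  ≡⟨ count-remove-false _ t (<ᵇ-irrefl (toℕ x)) x∈t ⟩
    count (λ y → toℕ y <ᵇ toℕ x) u  ≡⟨ count-⊆ _ s u nodup-s |s|≡|u| s⊆u ⟨
    count (λ y → toℕ y <ᵇ toℕ x) s  ≡⟨ count-map _ toℕ s ⟨
    b                               ∎
  regroup : ∀ b p e u → b * (b * (p * (e * u))) ≡ (b * e) * (u * p * b)
  regroup = solve-∀

rel-same-length-sgn : ∀ {r} (s t : List (Fin r)) → Nodup t → length s ≡ length t →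
                      rel _≟_ s t ≡ (if nodup _≟_ s ∧ s ⊆ᵇ t then sgn s * sgn t else 0ℤ)
rel-same-length-sgn s t nodup-t |s|≡|t| rewrite rel-same-length s t nodup-t |s|≡|t|
  with nodup _≟_ s in nodup-s | s ⊆ᵇ t in s⊆t
... | false | _     = refl
... | true  | false = refl
... | true  | true  = sgn-index-rearrangement s t nodup-s nodup-t |s|≡|t| (⊆ᵇ⇒⊆ s t s⊆t)

-- Sums over tuples

nodup∧⊆ᵇ-∷ : ∀ {r} (x : Fin r) σ t → x ∈ t → Nodup t →
             nodup _≟_ (x ∷ σ) ∧ (x ∷ σ) ⊆ᵇ t ≡ nodup _≟_ σ ∧ σ ⊆ᵇ remove x t
nodup∧⊆ᵇ-∷ x σ t x∈t nodup-t rewrite x∈t | ⊆ᵇ-remove x σ t nodup-t =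
  regroup (x ∈ᵇ σ) (nodup _≟_ σ) (σ ⊆ᵇ t)
  where
  regroup : ∀ a b c → (not a ∧ b) ∧ c ≡ b ∧ (not a ∧ c)
  regroup true  true  c = refl
  regroup true  false c = refl
  regroup false b     c = refl

module _ {r : ℕ} where

  ∑-tuples-suc : ∀ m (f : List (Fin r) → ℤ) →
                 ∑ (tuples r (suc m)) f ≡ ∑[ x ∈ allFin r ] ∑[ σ ∈ tuples r m ] f (x ∷ σ)
  ∑-tuples-suc m f =
    trans (∑-concatMap _ (allFin r) f) (∑-cong (allFin r) (λ x → ∑-map (x ∷_) (tuples r m) f))

  ∑-tuples-snoc : ∀ m (f : List (Fin r) → ℤ) →
                  ∑ (tuples r (suc m)) f ≡ ∑[ σ ∈ tuples r m ] ∑[ x ∈ allFin r ] f (σ ++ [ x ])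
  ∑-tuples-snoc zero    f = begin
    ∑ (tuples r 1) f                   ≡⟨ ∑-tuples-suc zero f ⟩
    ∑[ x ∈ allFin r ] (f [ x ] ℤ.+ 0ℤ) ≡⟨ ∑-cong (allFin r) (λ x → ℤₚ.+-identityʳ (f [ x ])) ⟩
    ∑[ x ∈ allFin r ] f [ x ]          ≡⟨ ℤₚ.+-identityʳ _ ⟨
    ∑[ x ∈ allFin r ] f [ x ] ℤ.+ 0ℤ   ∎
  ∑-tuples-snoc (suc m) f = begin
    ∑ (tuples r (suc (suc m))) f
      ≡⟨ ∑-tuples-suc (suc m) f ⟩
    ∑[ x ∈ allFin r ] ∑[ π ∈ tuples r (suc m) ] f (x ∷ π)
      ≡⟨ ∑-cong (allFin r) (λ x → ∑-tuples-snoc m (λ π → f (x ∷ π))) ⟩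
    ∑[ x ∈ allFin r ] ∑[ σ ∈ tuples r m ] ∑[ y ∈ allFin r ] f (x ∷ σ ++ [ y ])
      ≡⟨ ∑-tuples-suc m (λ σ → ∑[ y ∈ allFin r ] f (σ ++ [ y ])) ⟨
    ∑[ σ ∈ tuples r (suc m) ] ∑[ y ∈ allFin r ] f (σ ++ [ y ]) ∎

  ∑-tuples-cong : ∀ m {f g : List (Fin r) → ℤ} → (∀ σ → length σ ≡ m → f σ ≡ g σ) →
                  ∑ (tuples r m) f ≡ ∑ (tuples r m) g
  ∑-tuples-cong zero    f≗g = cong (ℤ._+ 0ℤ) (f≗g [] refl)
  ∑-tuples-cong (suc m) {f} {g} f≗g = begin
    ∑ (tuples r (suc m)) f                          ≡⟨ ∑-tuples-suc m f ⟩
    ∑[ x ∈ allFin r ] ∑[ σ ∈ tuples r m ] f (x ∷ σ) ≡⟨ ∑-cong (allFin r) (λ x → ∑-tuples-cong m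
                                                          (λ σ |σ|≡m → f≗g (x ∷ σ) (cong suc |σ|≡m))) ⟩
    ∑[ x ∈ allFin r ] ∑[ σ ∈ tuples r m ] g (x ∷ σ) ≡⟨ ∑-tuples-suc m g ⟨
    ∑ (tuples r (suc m)) g                          ∎

  ∑-rearrangements : ∀ m (t : List (Fin r)) → Nodup t → length t ≡ m → ∀ c →
                     ∑[ σ ∈ tuples r m ] (if nodup _≟_ σ ∧ σ ⊆ᵇ t then c else 0ℤ) ≡ + (m !) * c
  ∑-rearrangements zero    []  _       _       c = trans (ℤₚ.+-identityʳ c) (sym (ℤₚ.*-identityˡ c))
  ∑-rearrangements (suc m) t   nodup-t |t|≡1+m c = begin
    ∑[ σ ∈ tuples r (suc m) ] indicator t σ
      ≡⟨ ∑-tuples-suc m (indicator t) ⟩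
    ∑[ x ∈ allFin r ] ∑[ σ ∈ tuples r m ] indicator t (x ∷ σ)
      ≡⟨ ∑-cong (allFin r) (λ x → first-entry x (x ∈ᵇ t) refl) ⟩
    ∑[ x ∈ allFin r ] (if x ∈ᵇ t then + (m !) * c else 0ℤ)
      ≡⟨ ∑-indicator (_∈ᵇ t) (allFin r) (+ (m !) * c) ⟩
    + count (_∈ᵇ t) (allFin r) * (+ (m !) * c)
      ≡⟨ cong (λ k → + k * (+ (m !) * c)) count-t ⟩
    + suc m * (+ (m !) * c)
      ≡⟨ ℤₚ.*-assoc (+ suc m) (+ (m !)) c ⟨
    + suc m * + (m !) * c
      ≡⟨ cong (_* c) (ℤₚ.pos-* (suc m) (m !)) ⟨
    + (suc m !) * c ∎
    where
    indicator : List (Fin r) → List (Fin r) → ℤ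
    indicator t σ = if nodup _≟_ σ ∧ σ ⊆ᵇ t then c else 0ℤ
    count-t : count (_∈ᵇ t) (allFin r) ≡ suc m
    count-t = trans (count-∈ᵇ t (allFin r) nodup-t (nodup-allFin r) (λ y _ → ∈-allFin r y)) |t|≡1+m
    first-entry : ∀ x b → x ∈ᵇ t ≡ b →
                  ∑[ σ ∈ tuples r m ] indicator t (x ∷ σ) ≡ (if b then + (m !) * c else 0ℤ)
    first-entry x true  x∈t = trans
      (∑-cong (tuples r m) (λ σ → cong (λ b → if b then c else 0ℤ) (nodup∧⊆ᵇ-∷ x σ t x∈t nodup-t)))
      (∑-rearrangements m (remove x t) (nodup-remove x t nodup-t)
                        (ℕₚ.suc-injective (trans (length-remove t x∈t) |t|≡1+m)) c)
    first-entry x false x∉t = ∑-zero (tuples r m) (λ σ → cong (λ b → if b then c else 0ℤ)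
      (trans (cong (λ b → nodup _≟_ (x ∷ σ) ∧ (b ∧ σ ⊆ᵇ t)) x∉t) (∧-zeroʳ (nodup _≟_ (x ∷ σ)))))

-- The degree of ξ

coeff-map : ∀ {V W : Set} (eq : DecidableEquality V) (g : W → ℤ) (h : W → List V) (ws : List W) t →
            coeff eq (map (λ w → g w , h w) ws) t ≡ ∑[ w ∈ ws ] (g w * rel eq (h w) t)
coeff-map eq g h []       t = refl
coeff-map eq g h (w ∷ ws) t = cong (λ s → g w * rel eq (h w) t ℤ.+ s) (coeff-map eq g h ws t)

if-*ʳ : ∀ b (x y : ℤ) → (if b then x * y else 0ℤ) ≡ (if b then x else 0ℤ) * y
if-*ʳ true  x y = refl
if-*ʳ false x y = refl

map-proj₁-zip-snoc : {A B : Set} (σ : List A) (x : A) (ys : List B) → length σ ≡ length ys →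
                     map proj₁ (zip (σ ++ [ x ]) ys) ≡ σ
map-proj₁-zip-snoc []      x []       _         = refl
map-proj₁-zip-snoc (y ∷ σ) x (_ ∷ ys) |yσ|≡|ys| =
  cong (y ∷_) (map-proj₁-zip-snoc σ x ys (ℕₚ.suc-injective |yσ|≡|ys|))

pigeonhole : ∀ n (t : List (Fin (suc n))) → length t ≡ n → ∃[ k ] k ∉ t
pigeonhole n t |t|≡n with ∉-or-⊆ᵇ (allFin (suc n)) t
... | inj₁ k∉t   = k∉t
... | inj₂ all⊆t = ⊥-elim (ℕₚ.<-irrefl refl (subst (suc n ≤_) |t|≡n
       (subst (_≤ length t) (length-allFin (suc n))
         (length-⊆ (allFin (suc n)) t (nodup-allFin (suc n)) (⊆ᵇ⇒⊆ (allFin (suc n)) t all⊆t)))))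

sgnExtensions : ∀ {r} → List (Fin r) → ℤ
sgnExtensions {r} σ = ∑[ x ∈ allFin r ] (if nodup _≟_ (σ ++ [ x ]) then sgn (σ ++ [ x ]) else 0ℤ)

ξ-degree : ℕ → ℤ
ξ-degree n = sgnPow (suc n + 1) * + (n !)

ξ-degree-shift : ∀ n (k : Fin (suc n)) e →
                 + (n !) * (sgnPow (n ∸ toℕ k) * e) ≡ ξ-degree n * (sgnPow (toℕ k) * e)
ξ-degree-shift n k e = begin
  + (n !) * (sgnPow (n ∸ toℕ k) * e)
    ≡⟨ cong (λ s → + (n !) * (s * e)) (sgnPow-∸ n (toℕ k) (toℕ≤pred[n] k)) ⟩
  + (n !) * (sgnPow n * sgnPow (toℕ k) * e)
    ≡⟨ regroup (+ (n !)) (sgnPow n) (sgnPow (toℕ k)) e ⟩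
  -1ℤ * (sgnPow n * -1ℤ) * + (n !) * (sgnPow (toℕ k) * e)
    ≡⟨ cong (λ s → -1ℤ * s * + (n !) * (sgnPow (toℕ k) * e)) (sgnPow-+ n 1) ⟨
  ξ-degree n * (sgnPow (toℕ k) * e) ∎
  where
  regroup : ∀ f a b e → f * (a * b * e) ≡ -1ℤ * (a * -1ℤ) * f * (b * e)
  regroup = solve-∀

module _ (n : ℕ) where

  omit : Fin (suc n) → List (Fin (suc n))
  omit i = filterᵇ (_≢ᵇ i) (allFin (suc n))

  omit≡remove : ∀ i → omit i ≡ remove i (allFin (suc n))
  omit≡remove i = filter-≢ᵇ-remove i (allFin (suc n)) (nodup-allFin (suc n))

  length-remove-allFin : ∀ i → length (remove i (allFin (suc n))) ≡ n
  length-remove-allFin i =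
    ℕₚ.suc-injective (trans (length-remove (allFin (suc n)) (∈-allFin (suc n) i)) (length-allFin (suc n)))

  length-omit : ∀ i → length (omit i) ≡ n
  length-omit i = trans (cong length (omit≡remove i)) (length-remove-allFin i)

  coeff-ξ-chessFund : ∀ t → coeff _≟_ (pushforward (ξ (suc n)) (chessFund (suc n))) t ≡
                            ∑[ σ ∈ tuples (suc n) n ] (sgnExtensions σ * rel _≟_ σ t)
  coeff-ξ-chessFund t = begin
    coeff _≟_ (pushforward (ξ (suc n)) (chessFund (suc n))) t
      ≡⟨ cong (λ c → coeff _≟_ c t) (map-∘ (perms (suc n))) ⟨
    coeff _≟_ (map (λ π → sgn π , map proj₁ (rookSimplex (suc n) π)) (perms (suc n))) t
      ≡⟨ coeff-map _≟_ sgn (λ π → map proj₁ (rookSimplex (suc n) π)) (perms (suc n)) t ⟩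
    ∑[ π ∈ perms (suc n) ] term π
      ≡⟨ ∑-filter (nodup _≟_) (tuples (suc n) (suc n)) term ⟩
    ∑[ π ∈ tuples (suc n) (suc n) ] termIfNodup π
      ≡⟨ ∑-tuples-snoc n termIfNodup ⟩
    ∑[ σ ∈ tuples (suc n) n ] ∑[ x ∈ allFin (suc n) ] termIfNodup (σ ++ [ x ])
      ≡⟨ ∑-tuples-cong n (λ σ |σ|≡n → trans (∑-cong (allFin (suc n)) (λ x → drop-last σ x |σ|≡n))
                                             (∑-*ʳ (allFin (suc n)) (sgnIfNodup σ) (rel _≟_ σ t))) ⟩
    ∑[ σ ∈ tuples (suc n) n ] (sgnExtensions σ * rel _≟_ σ t) ∎
    where
    term termIfNodup : List (Fin (suc n)) → ℤ
    term π = sgn π * rel _≟_ (map proj₁ (rookSimplex (suc n) π)) t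
    termIfNodup π = if nodup _≟_ π then term π else 0ℤ
    sgnIfNodup : List (Fin (suc n)) → Fin (suc n) → ℤ
    sgnIfNodup σ x = if nodup _≟_ (σ ++ [ x ]) then sgn (σ ++ [ x ]) else 0ℤ
    drop-last : ∀ σ x → length σ ≡ n → termIfNodup (σ ++ [ x ]) ≡ sgnIfNodup σ x * rel _≟_ σ t
    drop-last σ x |σ|≡n = trans
      (cong (λ s → if nodup _≟_ (σ ++ [ x ]) then sgn (σ ++ [ x ]) * rel _≟_ s t else 0ℤ)
            (map-proj₁-zip-snoc σ x (allFin n) (trans |σ|≡n (sym (length-allFin n)))))
      (if-*ʳ (nodup _≟_ (σ ++ [ x ])) (sgn (σ ++ [ x ])) (rel _≟_ σ t))

  coeff-sphereFund : ∀ t → coeff _≟_ (sphereFund (suc n)) t ≡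
                           ∑[ i ∈ allFin (suc n) ] (sgnPow (toℕ i) * rel _≟_ (omit i) t)
  coeff-sphereFund t = coeff-map _≟_ (λ i → sgnPow (toℕ i)) omit (allFin (suc n)) t

  module _ (t : List (Fin (suc n))) (degenerate : ¬ (Nodup t × length t ≡ n)) where

    rel-degenerate : ∀ s → length s ≡ n → rel _≟_ s t ≡ 0ℤ
    rel-degenerate s |s|≡n with nodup _≟_ t Bool.≟ true
    ... | no ¬nodup-t = rel-¬nodupʳ s t (¬-not ¬nodup-t)
    ... | yes nodup-t = rel-length≢ s t (λ |s|≡|t| → degenerate (nodup-t , trans (sym |s|≡|t|) |s|≡n))

    coeff-ξ-chessFund-degenerate : coeff _≟_ (pushforward (ξ (suc n)) (chessFund (suc n))) t ≡ 0ℤ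
    coeff-ξ-chessFund-degenerate = begin
      coeff _≟_ (pushforward (ξ (suc n)) (chessFund (suc n))) t
        ≡⟨ coeff-ξ-chessFund t ⟩
      ∑[ σ ∈ tuples (suc n) n ] (sgnExtensions σ * rel _≟_ σ t)
        ≡⟨ ∑-tuples-cong n (λ σ |σ|≡n → trans (cong (sgnExtensions σ *_) (rel-degenerate σ |σ|≡n))
                                              (ℤₚ.*-zeroʳ (sgnExtensions σ))) ⟩
      ∑[ σ ∈ tuples (suc n) n ] 0ℤ
        ≡⟨ ∑-zero (tuples (suc n) n) (λ _ → refl) ⟩
      0ℤ ∎

    coeff-sphereFund-degenerate : coeff _≟_ (sphereFund (suc n)) t ≡ 0ℤ
    coeff-sphereFund-degenerate = trans (coeff-sphereFund t) (∑-zero (allFin (suc n)) (λ i →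
      trans (cong (sgnPow (toℕ i) *_) (rel-degenerate (omit i) (length-omit i))) (ℤₚ.*-zeroʳ (sgnPow (toℕ i)))))

    coeff-degenerate : coeff _≟_ (pushforward (ξ (suc n)) (chessFund (suc n))) t ≡
                       ξ-degree n * coeff _≟_ (sphereFund (suc n)) t
    coeff-degenerate = trans coeff-ξ-chessFund-degenerate
      (sym (trans (cong (ξ-degree n *_) coeff-sphereFund-degenerate) (ℤₚ.*-zeroʳ (ξ-degree n))))

  module _ (t : List (Fin (suc n))) (nodup-t : Nodup t) (|t|≡n : length t ≡ n) (k : Fin (suc n)) (k∉t : k ∉ t) where

    t̂ : List (Fin (suc n))
    t̂ = remove k (allFin (suc n))

    |t|≡|t̂| : length t ≡ length (t̂)
    |t|≡|t̂| = trans |t|≡n (sym (length-remove-allFin k))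

    t⊆t̂ : t ⊆ t̂
    t⊆t̂ y y∈t = ∈-remove⁺ k (allFin (suc n)) (∈∧∉⇒≢ t y∈t k∉t) (∈-allFin (suc n) y)

    t̂⊆t : t̂ ⊆ t
    t̂⊆t = ⊆-flip t (t̂) nodup-t |t|≡|t̂| t⊆t̂

    sgnExtensions-rearrangement : ∀ σ → Nodup σ → length σ ≡ n → σ ⊆ t →
                                  sgnExtensions σ ≡ sgn σ * sgnPow (n ∸ toℕ k)
    sgnExtensions-rearrangement σ nodup-σ |σ|≡n σ⊆t = begin
      sgnExtensions σ
        ≡⟨ ∑-cong (allFin (suc n)) (λ x → cong (λ b → if b then sgn (σ ++ [ x ]) else 0ℤ)
                                               (trans (nodup-snoc σ x nodup-σ) (only-k-extends x))) ⟩
      ∑[ x ∈ allFin (suc n) ] (if does (x ≟ k) then sgn (σ ++ [ x ]) else 0ℤ)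
        ≡⟨ ∑-single (allFin (suc n)) k (λ x → sgn (σ ++ [ x ])) (nodup-allFin (suc n)) (∈-allFin (suc n) k) ⟩
      sgnPow (inversions (map toℕ (σ ++ [ k ])))
        ≡⟨ cong (sgnPow ∘′ inversions) (map-++ toℕ σ [ k ]) ⟩
      sgnPow (inversions (map toℕ σ ++ [ toℕ k ]))
        ≡⟨ cong sgnPow (inversions-snoc (map toℕ σ) (toℕ k)) ⟩
      sgnPow (inversions (map toℕ σ) + count (toℕ k <ᵇ_) (map toℕ σ))
        ≡⟨ sgnPow-+ (inversions (map toℕ σ)) _ ⟩
      sgn σ * sgnPow (count (toℕ k <ᵇ_) (map toℕ σ))
        ≡⟨ cong (λ m → sgn σ * sgnPow m) above-k ⟩
      sgn σ * sgnPow (n ∸ toℕ k) ∎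
      where
      |σ|≡|t| = trans |σ|≡n (sym |t|≡n)
      only-k-extends : ∀ x → not (x ∈ᵇ σ) ≡ does (x ≟ k)
      only-k-extends x with x ≟ k
      ... | no x≢k = cong not (⊆-flip σ t nodup-σ |σ|≡|t| σ⊆t x
                                 (t̂⊆t x (∈-remove⁺ k (allFin (suc n)) x≢k (∈-allFin (suc n) x))))
      ... | yes refl with x ∈ᵇ σ in x∈σ
      ...   | false = refl
      ...   | true  = ⊥-elim (∈∧∉⇒≢ t (σ⊆t x x∈σ) k∉t refl)
      k<ᶠ_ : Fin (suc n) → Bool
      k<ᶠ y = toℕ k <ᵇ toℕ y
      above-k : count (toℕ k <ᵇ_) (map toℕ σ) ≡ n ∸ toℕ k
      above-k = begin
        count (toℕ k <ᵇ_) (map toℕ σ)    ≡⟨ count-map _ toℕ σ ⟩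
        count (k<ᶠ_) σ                   ≡⟨ count-⊆ (k<ᶠ_) σ t nodup-σ |σ|≡|t| σ⊆t ⟩
        count (k<ᶠ_) t                   ≡⟨ count-⊆ (k<ᶠ_) t t̂ nodup-t |t|≡|t̂| t⊆t̂ ⟩
        count (k<ᶠ_) t̂                   ≡⟨ count-remove-false (k<ᶠ_) (allFin (suc n))
                                                (<ᵇ-irrefl (toℕ k)) (∈-allFin (suc n) k) ⟨
        count (k<ᶠ_) (allFin (suc n))    ≡⟨ count-allFin-> n k ⟩
        n ∸ toℕ k                        ∎

    coeff-ξ-chessFund-nondegenerate : coeff _≟_ (pushforward (ξ (suc n)) (chessFund (suc n))) t ≡
                                      + (n !) * (sgnPow (n ∸ toℕ k) * sgn t)
    coeff-ξ-chessFund-nondegenerate = begin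
      coeff _≟_ (pushforward (ξ (suc n)) (chessFund (suc n))) t
        ≡⟨ coeff-ξ-chessFund t ⟩
      ∑[ σ ∈ tuples (suc n) n ] (sgnExtensions σ * rel _≟_ σ t)
        ≡⟨ ∑-tuples-cong n term≡ ⟩
      ∑[ σ ∈ tuples (suc n) n ] (if nodup _≟_ σ ∧ σ ⊆ᵇ t then sgnPow (n ∸ toℕ k) * sgn t else 0ℤ)
        ≡⟨ ∑-rearrangements n t nodup-t |t|≡n (sgnPow (n ∸ toℕ k) * sgn t) ⟩
      + (n !) * (sgnPow (n ∸ toℕ k) * sgn t) ∎
      where
      term≡ : ∀ σ → length σ ≡ n → sgnExtensions σ * rel _≟_ σ t ≡
                                   (if nodup _≟_ σ ∧ σ ⊆ᵇ t then sgnPow (n ∸ toℕ k) * sgn t else 0ℤ)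
      term≡ σ |σ|≡n rewrite rel-same-length-sgn σ t nodup-t (trans |σ|≡n (sym |t|≡n))
        with nodup _≟_ σ in nodup-σ | σ ⊆ᵇ t in σ⊆t
      ... | false | _     = ℤₚ.*-zeroʳ (sgnExtensions σ)
      ... | true  | false = ℤₚ.*-zeroʳ (sgnExtensions σ)
      ... | true  | true  = begin
        sgnExtensions σ * (sgn σ * sgn t)
          ≡⟨ cong (_* (sgn σ * sgn t)) (sgnExtensions-rearrangement σ nodup-σ |σ|≡n (⊆ᵇ⇒⊆ σ t σ⊆t)) ⟩
        sgn σ * sgnPow (n ∸ toℕ k) * (sgn σ * sgn t)
          ≡⟨ regroup (sgn σ) (sgnPow (n ∸ toℕ k)) (sgn t) ⟩
        sgn σ * (sgn σ * (sgnPow (n ∸ toℕ k) * sgn t))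
          ≡⟨ sgnPow-cancelˡ (inversions (map toℕ σ)) _ ⟩
        sgnPow (n ∸ toℕ k) * sgn t ∎
        where
        regroup : ∀ e s u → e * s * (e * u) ≡ e * (e * (s * u))
        regroup = solve-∀

    coeff-sphereFund-nondegenerate : coeff _≟_ (sphereFund (suc n)) t ≡ sgnPow (toℕ k) * sgn t
    coeff-sphereFund-nondegenerate = begin
      coeff _≟_ (sphereFund (suc n)) t
        ≡⟨ coeff-sphereFund t ⟩
      ∑[ i ∈ allFin (suc n) ] (sgnPow (toℕ i) * rel _≟_ (omit i) t)
        ≡⟨ ∑-cong (allFin (suc n)) only-k ⟩
      ∑[ i ∈ allFin (suc n) ] (if does (i ≟ k) then sgnPow (toℕ i) * sgn t else 0ℤ)
        ≡⟨ ∑-single (allFin (suc n)) k _ (nodup-allFin (suc n)) (∈-allFin (suc n) k) ⟩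
      sgnPow (toℕ k) * sgn t ∎
      where
      rel-omit : ∀ i → rel _≟_ (omit i) t ≡ (if omit i ⊆ᵇ t then sgn (omit i) * sgn t else 0ℤ)
      rel-omit i = trans (rel-same-length-sgn (omit i) t nodup-t (trans (length-omit i) (sym |t|≡n)))
        (cong (λ b → if b ∧ omit i ⊆ᵇ t then sgn (omit i) * sgn t else 0ℤ)
              (nodup-filter (_≢ᵇ i) (allFin (suc n)) (nodup-allFin (suc n))))
      omit⊆ᵇt : ∀ i → omit i ⊆ᵇ t ≡ does (i ≟ k)
      omit⊆ᵇt i with i ≟ k
      ... | yes refl = ⊆⇒⊆ᵇ (omit i) t (subst (_⊆ t) (sym (omit≡remove i)) t̂⊆t)
      ... | no i≢k with omit i ⊆ᵇ t in omit⊆t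
      ...   | false = refl
      ...   | true  = ⊥-elim (∈∧∉⇒≢ t (⊆ᵇ⇒⊆ (omit i) t omit⊆t k k∈omit) k∉t refl)
        where
        k∈omit : k ∈ omit i
        k∈omit = subst (k ∈_) (sym (omit≡remove i))
                       (∈-remove⁺ i (allFin (suc n)) (i≢k ∘′ sym) (∈-allFin (suc n) k))
      only-k : ∀ i → sgnPow (toℕ i) * rel _≟_ (omit i) t ≡
                     (if does (i ≟ k) then sgnPow (toℕ i) * sgn t else 0ℤ)
      only-k i rewrite rel-omit i | omit⊆ᵇt i with i ≟ k
      ... | no _     = ℤₚ.*-zeroʳ (sgnPow (toℕ i))
      ... | yes refl = cong (sgnPow (toℕ i) *_) (trans (cong (_* sgn t) (sgn-filterᵇ-allFin (suc n) (_≢ᵇ i)))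
                                                      (ℤₚ.*-identityˡ (sgn t)))

    coeff-nondegenerate : coeff _≟_ (pushforward (ξ (suc n)) (chessFund (suc n))) t ≡
                          ξ-degree n * coeff _≟_ (sphereFund (suc n)) t
    coeff-nondegenerate = begin
      coeff _≟_ (pushforward (ξ (suc n)) (chessFund (suc n))) t
        ≡⟨ coeff-ξ-chessFund-nondegenerate ⟩
      + (n !) * (sgnPow (n ∸ toℕ k) * sgn t)
        ≡⟨ ξ-degree-shift n k (sgn t) ⟩
      ξ-degree n * (sgnPow (toℕ k) * sgn t)
        ≡⟨ cong (ξ-degree n *_) coeff-sphereFund-nondegenerate ⟨
      ξ-degree n * coeff _≟_ (sphereFund (suc n)) t ∎

proposition5p4 : (r : ℕ) → 2 ≤ r →
    HasDegree _≟_ (ξ r) (chessFund r) (sphereFund r) (((- 1ℤ) ^ (r + 1)) * (+ ((r ∸ 1) !)))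
proposition5p4 (suc n) _ t with nodup _≟_ t Bool.≟ true ×-dec length t ℕ.≟ n
... | yes (nodup-t , |t|≡n) =
  let (k , k∉t) = pigeonhole n t |t|≡n in coeff-nondegenerate n t nodup-t |t|≡n k k∉t
... | no degenerate         = coeff-degenerate n t degenerate
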